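{- Let $N = q^k n^2$ be an odd perfect number written in Eulerian form, i.e. $q$ is a prime with $q \equiv k \equiv 1 \pmod 4$, $n$ is a positive integer, and $\gcd(q,n)=1$. If $$\frac{\sigma(n)}{q} = \frac{\sigma(q^k)}{n},$$ then $k > 1$.
   Context: $\sigma(x)$ denotes the sum of the positive divisors of the positive integer $x$. A positive integer $N$ is perfect if $\sigma(N) = 2N$. -}

module Defs where

open import Data.Nat using (ℕ; zero; suc; _+_; _*_; _^_; _%_; _<_)
open import Data.Nat.Divisibility using (_∣_; _∣?_)
open import Data.Nat.GCD using (gcd)
open import Data.Nat.Primality using (Prime)
open import Data.Nat.Properties using ()
open import Data.List using (List; filter; map; upTo)
open import Data.Nat.ListAction using (sum)
open import Data.Product using (_×_)
open import Relation.Binary.PropositionalEquality using (_≡_)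

divisors : ℕ → List ℕ
divisors x = filter (λ d → d ∣? x) (map suc (upTo x))

σ : ℕ → ℕ
σ x = sum (divisors x)

Perfect : ℕ → Set
Perfect N = σ N ≡ 2 * N

Odd : ℕ → Set
Odd N = N % 2 ≡ 1

{-# OPTIONS --safe #-}
module Submission where

open import Defs
open import Algebra.Properties.CommutativeSemigroup using (x∙yz≈y∙xz)
open import Data.Empty using (⊥-elim)
open import Data.List using (List; []; _∷_; _++_; map; upTo)
open import Data.List.Membership.Propositional using (_∈_)
open import Data.List.Membership.Propositional.Properties
open import Data.List.Relation.Binary.Disjoint.Propositional using (Disjoint)
open import Data.List.Relation.Binary.Subset.Propositional using (_⊆_)
import Data.List.Relation.Unary.All as All
import Data.List.Relation.Unary.AllPairs as AllPairs
open import Data.List.Relation.Unary.Any using (here; there)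
open import Data.List.Relation.Unary.Unique.Propositional using (Unique)
import Data.List.Relation.Unary.Unique.Propositional.Properties as Unique
open import Data.Nat using (ℕ; zero; suc; _+_; _*_; _^_; _%_; _/_; _<_; _≤_; z≤n; s≤s; NonZero; >-nonZero; ≢-nonZero⁻¹; nonTrivial⇒n>1)
open import Data.Nat.Coprimality using (Coprime; gcd≡1⇒coprime; coprime-divisor)
import Data.Nat.Coprimality as Coprimality
open import Data.Nat.Divisibility
open import Data.Nat.DivMod using (m≡m%n+[m/n]*n)
open import Data.Nat.GCD using (gcd)
open import Data.Nat.ListAction using (sum)
open import Data.Nat.ListAction.Properties using (sum-++)
open import Data.Nat.Primality using (Prime; prime⇒irreducible; prime⇒nonZero; prime⇒nonTrivial; euclidsLemma)
open import Data.Nat.Properties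
open import Data.Nat.Tactic.RingSolver using (solve)
open import Data.Product using (_,_; proj₂)
open import Data.Sum using (inj₁; inj₂; [_,_]′)
open import Function using (id; _∘_)
open import Relation.Binary.PropositionalEquality
open import Relation.Nullary using (¬_; contradiction)

-- Since k ≡ 1 (mod 4), only k = 1 has to be excluded.  Then coprimality turns
-- σ(n) n = (1 + q) q into 1 + q = m n with σ(n) = m q.  As q ∤ n², the divisors of
-- n² and their q-multiples are distinct divisors of N = q n², and so are the n d for d ∣ n;
-- hence 2 q n² = σ(N) ≥ (1 + q) σ(n²) ≥ (1 + q) n σ(n) = m² q n², forcing m = 1.
-- But then n = 1 + q is even, while N is odd.

sum-++-∷ : ∀ x ys zs → sum (ys ++ x ∷ zs) ≡ x + sum (ys ++ zs)
sum-++-∷ x ys zs = begin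
  sum (ys ++ x ∷ zs)     ≡⟨ sum-++ ys (x ∷ zs) ⟩
  sum ys + (x + sum zs)  ≡⟨ x∙yz≈y∙xz +-commutativeSemigroup (sum ys) x (sum zs) ⟩
  x + (sum ys + sum zs)  ≡⟨ cong (x +_) (sum-++ ys zs) ⟨
  x + sum (ys ++ zs)     ∎
  where open ≡-Reasoning

sum-mono-⊆ : ∀ {xs ys : List ℕ} → Unique xs → xs ⊆ ys → sum xs ≤ sum ys
sum-mono-⊆ {[]} _ _ = z≤n
sum-mono-⊆ {x ∷ xs} x∷xs-unique x∷xs⊆ys with ∈-∃++ (x∷xs⊆ys (here refl))
... | ys₁ , ys₂ , refl =
  subst (x + sum xs ≤_) (sym (sum-++-∷ x ys₁ ys₂))
    (+-monoʳ-≤ x (sum-mono-⊆ (AllPairs.tail x∷xs-unique) xs⊆ys₁++ys₂))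
  where
  xs⊆ys₁++ys₂ : xs ⊆ ys₁ ++ ys₂
  xs⊆ys₁++ys₂ {e} e∈xs with ∈-++⁻ ys₁ (x∷xs⊆ys (there e∈xs))
  ... | inj₁ e∈ys₁ = ∈-++⁺ˡ e∈ys₁
  ... | inj₂ (here refl) = ⊥-elim (All.lookup (AllPairs.head x∷xs-unique) e∈xs refl)
  ... | inj₂ (there e∈ys₂) = ∈-++⁺ʳ ys₁ e∈ys₂

sum-map-*ˡ : ∀ c (xs : List ℕ) → sum (map (c *_) xs) ≡ c * sum xs
sum-map-*ˡ c [] = sym (*-zeroʳ c)
sum-map-*ˡ c (x ∷ xs) = begin
  c * x + sum (map (c *_) xs)  ≡⟨ cong (c * x +_) (sum-map-*ˡ c xs) ⟩
  c * x + c * sum xs           ≡⟨ *-distribˡ-+ c x (sum xs) ⟨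
  c * (x + sum xs)             ∎
  where open ≡-Reasoning

divisors-unique : ∀ x → Unique (divisors x)
divisors-unique x = Unique.filter⁺ (_∣? x) (Unique.map⁺ suc-injective (Unique.upTo⁺ x))

∈-divisors⁻ : ∀ {d x} → d ∈ divisors x → d ∣ x
∈-divisors⁻ {x = x} d∈ = proj₂ (∈-filter⁻ (_∣? x) {xs = map suc (upTo x)} d∈)

∈-divisors⁺ : ∀ {d x} .{{_ : NonZero x}} → d ∣ x → d ∈ divisors x
∈-divisors⁺ {zero} {x} 0∣x = contradiction (0∣⇒≡0 0∣x) (≢-nonZero⁻¹ x)
∈-divisors⁺ {suc d} {x} d∣x = ∈-filter⁺ (_∣? x) (∈-map⁺ suc (∈-upTo⁺ (∣⇒≤ d∣x))) d∣x

sum≤σ : ∀ {ds x} .{{_ : NonZero x}} → Unique ds → (∀ {d} → d ∈ ds → d ∣ x) → sum ds ≤ σ x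
sum≤σ ds-unique ds∣x = sum-mono-⊆ ds-unique (λ d∈ds → ∈-divisors⁺ (ds∣x d∈ds))

*-σ≤σ-* : ∀ a b .{{_ : NonZero a}} .{{_ : NonZero b}} → a * σ b ≤ σ (a * b)
*-σ≤σ-* a b = subst (_≤ σ (a * b)) (sum-map-*ˡ a (divisors b))
  (sum≤σ {{m*n≢0 a b}} (Unique.map⁺ (*-cancelˡ-≡ _ _ a) (divisors-unique b)) a*d∣a*b)
  where
  a*d∣a*b : ∀ {e} → e ∈ map (a *_) (divisors b) → e ∣ a * b
  a*d∣a*b e∈ with ∈-map⁻ (a *_) e∈
  ... | d , d∈ , refl = *-monoʳ-∣ a (∈-divisors⁻ d∈)

[1+a]*σ≤σ-* : ∀ a b .{{_ : NonZero a}} .{{_ : NonZero b}} → ¬ a ∣ b → (1 + a) * σ b ≤ σ (a * b)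
[1+a]*σ≤σ-* a b a∤b = subst (_≤ σ (a * b)) sum≡
  (sum≤σ {{m*n≢0 a b}} (Unique.++⁺ (divisors-unique b) a*D-unique disjoint) ∣a*b)
  where
  D = divisors b
  sum≡ : sum (D ++ map (a *_) D) ≡ (1 + a) * σ b
  sum≡ = trans (sum-++ D (map (a *_) D)) (cong (σ b +_) (sum-map-*ˡ a D))
  a*D-unique : Unique (map (a *_) D)
  a*D-unique = Unique.map⁺ (*-cancelˡ-≡ _ _ a) (divisors-unique b)
  disjoint : Disjoint D (map (a *_) D)
  disjoint (d∈ , ad∈) with ∈-map⁻ (a *_) ad∈
  ... | d′ , _ , refl = a∤b (∣-trans (m∣m*n d′) (∈-divisors⁻ d∈))
  ∣a*b : ∀ {e} → e ∈ D ++ map (a *_) D → e ∣ a * b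
  ∣a*b e∈ with ∈-++⁻ D e∈
  ... | inj₁ d∈ = ∣n⇒∣m*n a (∈-divisors⁻ d∈)
  ... | inj₂ ad∈ with ∈-map⁻ (a *_) ad∈
  ...   | d , d∈ , refl = *-monoʳ-∣ a (∈-divisors⁻ d∈)

prime⇒1<p : ∀ {p} → Prime p → 1 < p
prime⇒1<p {p} p-prime = nonTrivial⇒n>1 p {{prime⇒nonTrivial p-prime}}

σ[p]≡1+p : ∀ {p} → Prime p → σ p ≡ 1 + p
σ[p]≡1+p {p} p-prime = ≤-antisym σ[p]≤1+p 1+p≤σ[p]
  where
  instance _ = prime⇒nonZero p-prime
  σ[p]≤1+p : σ p ≤ 1 + p
  σ[p]≤1+p = subst (σ p ≤_) (cong (1 +_) (+-identityʳ p))
    (sum-mono-⊆ (divisors-unique p) divisors⊆1∷p∷[])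
    where
    divisors⊆1∷p∷[] : divisors p ⊆ 1 ∷ p ∷ []
    divisors⊆1∷p∷[] d∈ = [ here , there ∘ here ]′ (prime⇒irreducible p-prime (∈-divisors⁻ d∈))
  1+p≤σ[p] : 1 + p ≤ σ p
  1+p≤σ[p] = subst₂ _≤_ (*-identityʳ (1 + p)) (cong σ (*-identityʳ p))
    ([1+a]*σ≤σ-* p 1 (λ p∣1 → <⇒≢ (prime⇒1<p p-prime) (sym (∣1⇒≡1 p∣1))))

%4≡1⇒2∣1+ : ∀ q → q % 4 ≡ 1 → 2 ∣ 1 + q
%4≡1⇒2∣1+ q q%4≡1 = divides (1 + q / 4 * 2) (begin
  1 + q                    ≡⟨ cong (1 +_) (m≡m%n+[m/n]*n q 4) ⟩
  1 + (q % 4 + q / 4 * 4)  ≡⟨ cong (λ r → 1 + (r + q / 4 * 4)) q%4≡1 ⟩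
  2 + q / 4 * 4            ≡⟨ cong (2 +_) (*-assoc (q / 4) 2 2) ⟨
  2 + q / 4 * 2 * 2        ≡⟨ *-distribʳ-+ 2 1 (q / 4 * 2) ⟨
  (1 + q / 4 * 2) * 2      ∎)
  where open ≡-Reasoning

coprime⇒prime∤n*n : ∀ {p n} → Prime p → Coprime p n → ¬ p ∣ n * n
coprime⇒prime∤n*n {p} {n} p-prime cop p∣n*n =
  <⇒≢ (prime⇒1<p p-prime) (sym (cop (∣-refl , [ id , id ]′ (euclidsLemma n n p-prime p∣n*n))))

[1+q]*n*σ[n]≤σ[q*n*n] : ∀ {q n} .{{_ : NonZero n}} → Prime q → Coprime q n →
  (1 + q) * (n * σ n) ≤ σ (q * (n * n))
[1+q]*n*σ[n]≤σ[q*n*n] {q} {n} q-prime cop = ≤-trans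
  (*-monoʳ-≤ (1 + q) (*-σ≤σ-* n n))
  ([1+a]*σ≤σ-* q (n * n) {{prime⇒nonZero q-prime}} {{m*n≢0 n n}} (coprime⇒prime∤n*n q-prime cop))

m*m≤2 : ∀ {q n m} .{{_ : NonZero n}} → Perfect (q * (n * n)) → Prime q → Coprime q n →
  σ n * n ≡ (1 + q) * q → 1 + q ≡ m * n → m * m ≤ 2
m*m≤2 {q} {n} {m} perfect q-prime cop eq 1+q≡m*n =
  *-cancelʳ-≤ (m * m) 2 (q * (n * n)) {{m*n≢0 q (n * n) {{prime⇒nonZero q-prime}} {{m*n≢0 n n}}}} (begin
    m * m * (q * (n * n))  ≡⟨ solve (m ∷ n ∷ q ∷ []) ⟩
    m * n * (n * (m * q))  ≡⟨ cong₂ (λ a b → a * (n * b)) 1+q≡m*n σ[n]≡m*q ⟨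
    (1 + q) * (n * σ n)    ≤⟨ [1+q]*n*σ[n]≤σ[q*n*n] q-prime cop ⟩
    σ (q * (n * n))        ≡⟨ perfect ⟩
    2 * (q * (n * n))      ∎)
  where
  open ≤-Reasoning
  σ[n]≡m*q : σ n ≡ m * q
  σ[n]≡m*q = *-cancelʳ-≡ (σ n) (m * q) n (begin-equality
    σ n * n      ≡⟨ eq ⟩
    (1 + q) * q  ≡⟨ cong (_* q) 1+q≡m*n ⟩
    m * n * q    ≡⟨ solve (m ∷ n ∷ q ∷ []) ⟩
    m * q * n    ∎)

odd⇒2∤ : ∀ {N} → Odd N → ¬ 2 ∣ N
odd⇒2∤ {N} odd 2∣N = 0≢1+n (trans (sym (n∣m⇒m%n≡0 N 2 2∣N)) odd)

σ[n]*n≢[1+q]*q : ∀ {q n} .{{_ : NonZero n}} → Odd (q * (n * n)) → Perfect (q * (n * n)) →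
  Prime q → q % 4 ≡ 1 → Coprime q n → σ n * n ≢ (1 + q) * q
σ[n]*n≢[1+q]*q {q} {n} odd perfect q-prime q%4≡1 cop eq
  with coprime-divisor (Coprimality.sym cop) (divides (σ n) (trans (*-comm q (1 + q)) (sym eq)))
... | divides zero 1+q≡0 = 1+n≢0 1+q≡0
... | divides 1 1+q≡1*n = odd⇒2∤ odd (∣n⇒∣m*n q (∣n⇒∣m*n n 2∣n))
  where
  2∣n : 2 ∣ n
  2∣n = subst (2 ∣_) (trans 1+q≡1*n (*-identityˡ n)) (%4≡1⇒2∣1+ q q%4≡1)
... | divides m@(suc (suc _)) 1+q≡m*n =
  <⇒≱ (s≤s (s≤s (s≤s z≤n))) (≤-trans (*-mono-≤ 2≤m 2≤m) (m*m≤2 perfect q-prime cop eq 1+q≡m*n))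
  where
  2≤m : 2 ≤ m
  2≤m = s≤s (s≤s z≤n)

mainTheorem3 : (N q k n : ℕ) → Odd N → Perfect N → N ≡ q ^ k * (n * n) →
    Prime q → q % 4 ≡ 1 → k % 4 ≡ 1 → 0 < n → gcd q n ≡ 1 →
    σ n * n ≡ σ (q ^ k) * q →
    1 < k
mainTheorem3 N q 0 n _ _ _ _ _ () _ _ _
mainTheorem3 N q 1 n odd perfect N≡q¹n² q-prime q%4≡1 _ 0<n gcd≡1 eq =
  ⊥-elim (σ[n]*n≢[1+q]*q {{>-nonZero 0<n}} (subst Odd N≡qn² odd) (subst Perfect N≡qn² perfect)
    q-prime q%4≡1 (gcd≡1⇒coprime gcd≡1) (trans eq (cong (_* q) σ[q¹]≡1+q)))
  where
  N≡qn² : N ≡ q * (n * n)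
  N≡qn² = trans N≡q¹n² (cong (_* (n * n)) (*-identityʳ q))
  σ[q¹]≡1+q : σ (q ^ 1) ≡ 1 + q
  σ[q¹]≡1+q = trans (cong σ (*-identityʳ q)) (σ[p]≡1+p q-prime)
mainTheorem3 _ _ (suc (suc _)) _ _ _ _ _ _ _ _ _ _ = s≤s (s≤s z≤n)
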